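{- Let $p$ be a prime, let $M$ be a field of characteristic $p$ and let $A\subseteq M$ be a $\lambda$-closed subring. Then $F=\mathrm{Frac}(A)$ is a $\lambda$-closed subfield of $M$.
   Context: A tuple $b$ (of any length) in $M$ is $p$-independent in $M$ if no entry $x$ of $b$ lies in $M^p(b\setminus\{x\})$. For a $p$-independent $\kappa$-tuple $b$, the monomials $b^m=\prod_\beta b_\beta^{m_\beta}$ with $m\in\{0,\dots,p-1\}^\kappa$ of finite support form an $M^p$-basis of $M^p(b)$, so every $t\in M^p(b)$ is uniquely $t=\sum_m(\lambda^b_m(t))^pb^m$ with $\lambda^b_m(t)\in M$. A subring $A\subseteq M$ is $\lambda$-closed in $M$ if for every tuple $b$ from $A$ which is $p$-independent in $M$, every monomial $m$ and every $a\in A\cap M^p(b)$, one has $\lambda^b_m(a)\in A$. -}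

module Defs where

open import Level using (Level; _⊔_) renaming (suc to lsuc)
open import Algebra.Bundles using (CommutativeRing)
open import Data.Nat using (ℕ; zero; suc; _<_)
open import Data.Product using (Σ; ∃; _×_; _,_; proj₁; proj₂)
open import Data.List using (List; []; _∷_; foldr)
open import Data.List.Relation.Unary.All using (All)
open import Data.List.Relation.Unary.AllPairs using (AllPairs)
open import Data.List.Relation.Unary.Unique.Propositional using (Unique)
open import Data.List.Membership.Propositional using (_∉_)
open import Relation.Nullary using (¬_)
open import Relation.Binary.PropositionalEquality using (_≡_; _≢_)

record Field (c ℓ : Level) : Set (lsuc (c ⊔ ℓ)) where
  field
    commutativeRing : CommutativeRing c ℓ
  open CommutativeRing commutativeRing public
  field
    0≉1     : ¬ (0# ≈ 1#)
    inverse : ∀ x → ¬ (x ≈ 0#) → ∃ λ y → x * y ≈ 1#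

module FieldTheory {c ℓ : Level} (M : Field c ℓ) where
  open Field M

  _^_ : Carrier → ℕ → Carrier
  x ^ zero  = 1#
  x ^ suc n = x * (x ^ n)

  _·1 : ℕ → Carrier
  zero ·1  = 0#
  suc n ·1 = 1# + (n ·1)

  HasChar : ℕ → Set ℓ
  HasChar p = (p ·1) ≈ 0#

  record IsSubring {r : Level} (A : Carrier → Set r) : Set (c ⊔ ℓ ⊔ r) where
    field
      resp : ∀ {x y} → x ≈ y → A x → A y
      0∈   : A 0#
      1∈   : A 1#
      +∈   : ∀ {x y} → A x → A y → A (x + y)
      -∈   : ∀ {x} → A x → A (- x)
      *∈   : ∀ {x y} → A x → A y → A (x * y)

  record IsSubfield {r : Level} (A : Carrier → Set r) : Set (c ⊔ ℓ ⊔ r) where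
    field
      isSubring : IsSubring A
      inv∈      : ∀ {x y} → A x → ¬ (x ≈ 0#) → x * y ≈ 1# → A y

  -- Frac(A), realised inside M: elements x with x * d ≈ a for some a, d ∈ A, d ≉ 0
  Frac : {r : Level} → (Carrier → Set r) → Carrier → Set (c ⊔ ℓ ⊔ r)
  Frac A x = Σ Carrier λ a → Σ Carrier λ d →
               A a × A d × ¬ (d ≈ 0#) × (x * d ≈ a)

  -- M^p(S): the subfield of M generated by M^p together with the set S
  -- (least subset containing all p-th powers and S, closed under field operations)
  data Gen (p : ℕ) {r : Level} (S : Carrier → Set r) : Carrier → Set (c ⊔ ℓ ⊔ r) where
    pth  : ∀ y → Gen p S (y ^ p)
    gen  : ∀ {x} → S x → Gen p S x
    plus : ∀ {x y} → Gen p S x → Gen p S y → Gen p S (x + y)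
    neg  : ∀ {x} → Gen p S x → Gen p S (- x)
    mult : ∀ {x y} → Gen p S x → Gen p S y → Gen p S (x * y)
    inv  : ∀ {x y} → Gen p S x → ¬ (x ≈ 0#) → x * y ≈ 1# → Gen p S y
    resp : ∀ {x y} → x ≈ y → Gen p S x → Gen p S y

  Entries : {I : Set c} → (I → Carrier) → Carrier → Set c
  Entries {I} b x = Σ I λ j → b j ≡ x

  EntriesWithout : {I : Set c} → (I → Carrier) → I → Carrier → Set c
  EntriesWithout {I} b i x = Σ I λ j → (j ≢ i) × (b j ≡ x)

  PIndep : (p : ℕ) {I : Set c} → (I → Carrier) → Set (c ⊔ ℓ)
  PIndep p {I} b = ∀ i → ¬ Gen p (EntriesWithout b i) (b i)

  record Monomial (p : ℕ) (I : Set c) : Set c where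
    field
      exps      : I → ℕ
      exps<p    : ∀ i → exps i < p
      support   : List I
      uniqueSup : Unique support
      offSup    : ∀ i → i ∉ support → exps i ≡ 0

  evalMon : {p : ℕ} {I : Set c} → (I → Carrier) → Monomial p I → Carrier
  evalMon b m = foldr (λ i acc → (b i ^ Monomial.exps m i) * acc) 1# (Monomial.support m)

  DistinctMon : {p : ℕ} {I : Set c} → Monomial p I → Monomial p I → Set c
  DistinctMon m m' = ¬ (∀ i → Monomial.exps m i ≡ Monomial.exps m' i)

  -- a finite list of (coefficient, monomial) pairs with pairwise distinct monomials
  -- representing t = Σ coeff^p b^m; for p-independent b its coefficients are
  -- exactly the λ^b_m(t) (all other λ^b_m(t) being 0)
  Represents : (p : ℕ) {I : Set c} → (I → Carrier) → Carrier
             → List (Carrier × Monomial p I) → Set (c ⊔ ℓ)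
  Represents p b t rep =
    AllPairs (λ u v → DistinctMon (proj₂ u) (proj₂ v)) rep ×
    (t ≈ foldr (λ u acc → ((proj₁ u ^ p) * evalMon b (proj₂ u)) + acc) 0# rep)

  LambdaClosed : {r : Level} (p : ℕ) → (Carrier → Set r) → Set (lsuc c ⊔ ℓ ⊔ r)
  LambdaClosed p A = ∀ (I : Set c) (b : I → Carrier) →
    (∀ i → A (b i)) → PIndep p b →
    ∀ a → A a → Gen p (Entries b) a →
    ∀ rep → Represents p b a rep → All (λ u → A (proj₁ u)) rep

-- Write each entry of b ∈ Frac(A) as nᵢ/dᵢ with nᵢ, dᵢ ∈ A. Multiplying bᵢ by the p-th power dᵢᵖ
-- changes neither M^p(b) nor p-independence, and gives a tuple b' = (bᵢ dᵢᵖ) with entries in A.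
-- Likewise, for a = x/y, a' = a yᵖ lies in A. A representation a = Σ uᵖ bᵐ becomes
-- a' = Σ (u y d⁻ᵐ)ᵖ b'ᵐ, so λ-closedness of A puts u y d⁻ᵐ in A, whence u ∈ Frac(A).
module Submission where

open import Defs
open import Level using (Level)
open import Data.Nat as ℕ using (ℕ; zero; suc)
import Data.Nat.Properties as ℕ using (*-comm)
open import Data.Nat.Primality using (Prime; prime⇒nonZero)
open import Data.Product using (_×_; _,_; proj₁; proj₂)
open import Data.List using (List; []; _∷_; foldr; map)
open import Data.List.Relation.Unary.All using (All)
import Data.List.Relation.Unary.All as All
import Data.List.Relation.Unary.All.Properties as All
import Data.List.Relation.Unary.AllPairs.Properties as AllPairs
open import Relation.Nullary using (¬_)
open import Relation.Binary.PropositionalEquality as ≡ using (_≡_)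
import Algebra.Properties.CommutativeSemiring.Exp as Exp
import Algebra.Properties.CommutativeSemigroup as CommSemigroupProperties
import Algebra.Properties.Ring as RingProperties
import Algebra.Solver.Ring.NaturalCoefficients.Default as Solver

module FracLambdaClosed {c ℓ : Level} (M : Field c ℓ) where
  open Field M
  open FieldTheory M
  open import Relation.Binary.Reasoning.Setoid setoid
  open RingProperties ring using (-‿distribˡ-*)
  open CommSemigroupProperties *-commutativeSemigroup using (interchange)
  open Solver commutativeSemiring using (solve; _:=_; _:+_; _:*_)
  private module E = Exp commutativeSemiring

  *-nonzero : ∀ {x y} → ¬ x ≈ 0# → ¬ y ≈ 0# → ¬ x * y ≈ 0#
  *-nonzero {x} {y} x≉0 y≉0 xy≈0 with inverse y y≉0
  ... | y⁻¹ , y*y⁻¹≈1 = x≉0 (begin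
    x              ≈⟨ *-identityʳ x ⟨
    x * 1#         ≈⟨ *-congˡ y*y⁻¹≈1 ⟨
    x * (y * y⁻¹)  ≈⟨ *-assoc x y y⁻¹ ⟨
    (x * y) * y⁻¹  ≈⟨ *-congʳ xy≈0 ⟩
    0# * y⁻¹       ≈⟨ zeroˡ y⁻¹ ⟩
    0#             ∎)

  1≉0 : ¬ 1# ≈ 0#
  1≉0 1≈0 = 0≉1 (sym 1≈0)

  -- Defs has its own power function; it agrees with the library's, whose laws we transport.
  private
    ^≡^ : ∀ x n → x ^ n ≡ x E.^ n
    ^≡^ x zero    = ≡.refl
    ^≡^ x (suc n) = ≡.cong (x *_) (^≡^ x n)

  ^-congˡ : ∀ {x y} n → x ≈ y → x ^ n ≈ y ^ n
  ^-congˡ {x} {y} n x≈y rewrite ^≡^ x n | ^≡^ y n = E.^-congˡ n x≈y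

  ^-distrib-* : ∀ x y n → (x * y) ^ n ≈ x ^ n * y ^ n
  ^-distrib-* x y n rewrite ^≡^ (x * y) n | ^≡^ x n | ^≡^ y n = E.^-distrib-* x y n

  ^-comm : ∀ x m n → (x ^ m) ^ n ≈ (x ^ n) ^ m
  ^-comm x m n rewrite ^≡^ (x ^ m) n | ^≡^ x m | ^≡^ (x ^ n) m | ^≡^ x n = begin
    (x E.^ m) E.^ n  ≈⟨ E.^-assocʳ x m n ⟩
    x E.^ (m ℕ.* n)  ≡⟨ ≡.cong (x E.^_) (ℕ.*-comm m n) ⟩
    x E.^ (n ℕ.* m)  ≈⟨ E.^-assocʳ x n m ⟨
    (x E.^ n) E.^ m  ∎

  1^n≈1 : ∀ n → 1# ^ n ≈ 1#
  1^n≈1 zero    = refl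
  1^n≈1 (suc n) = trans (*-identityˡ _) (1^n≈1 n)

  x≈x*dⁿ*eⁿ : ∀ {d e} x n → d * e ≈ 1# → x ≈ x * d ^ n * e ^ n
  x≈x*dⁿ*eⁿ {d} {e} x n d*e≈1 = begin
    x                    ≈⟨ *-identityʳ x ⟨
    x * 1#               ≈⟨ *-congˡ (1^n≈1 n) ⟨
    x * 1# ^ n           ≈⟨ *-congˡ (^-congˡ n d*e≈1) ⟨
    x * (d * e) ^ n      ≈⟨ *-congˡ (^-distrib-* d e n) ⟩
    x * (d ^ n * e ^ n)  ≈⟨ *-assoc x _ _ ⟨
    x * d ^ n * e ^ n    ∎

  -- evalMon b m unfolds to powProd b (exps m) (support m).
  powProd : {I : Set c} → (I → Carrier) → (I → ℕ) → List I → Carrier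
  powProd f k = foldr (λ i acc → (f i ^ k i) * acc) 1#

  module _ {I : Set c} (k : I → ℕ) where

    powProd-cong : ∀ {f g} → (∀ i → f i ≈ g i) → ∀ is → powProd f k is ≈ powProd g k is
    powProd-cong f≈g []       = refl
    powProd-cong f≈g (i ∷ is) = *-cong (^-congˡ (k i) (f≈g i)) (powProd-cong f≈g is)

    powProd-distrib-* : ∀ f g is →
      powProd (λ i → f i * g i) k is ≈ powProd f k is * powProd g k is
    powProd-distrib-* f g []       = sym (*-identityˡ 1#)
    powProd-distrib-* f g (i ∷ is) = begin
      (f i * g i) ^ k i * powProd (λ j → f j * g j) k is
        ≈⟨ *-cong (^-distrib-* (f i) (g i) (k i)) (powProd-distrib-* f g is) ⟩
      (f i ^ k i * g i ^ k i) * (powProd f k is * powProd g k is)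
        ≈⟨ interchange _ _ _ _ ⟩
      (f i ^ k i * powProd f k is) * (g i ^ k i * powProd g k is)  ∎

    powProd-^ : ∀ f n is → powProd (λ i → f i ^ n) k is ≈ powProd f k is ^ n
    powProd-^ f n []       = sym (1^n≈1 n)
    powProd-^ f n (i ∷ is) = begin
      (f i ^ n) ^ k i * powProd (λ j → f j ^ n) k is
        ≈⟨ *-cong (^-comm (f i) n (k i)) (powProd-^ f n is) ⟩
      (f i ^ k i) ^ n * powProd f k is ^ n   ≈⟨ ^-distrib-* _ _ n ⟨
      (f i ^ k i * powProd f k is) ^ n       ∎

    powProd-1 : ∀ is → powProd (λ _ → 1#) k is ≈ 1#
    powProd-1 []       = refl
    powProd-1 (i ∷ is) = trans (*-cong (1^n≈1 (k i)) (powProd-1 is)) (*-identityˡ 1#)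

  module _ {p : ℕ} {I : Set c} (m : Monomial p I) where
    open Monomial m

    evalMon-rescale : ∀ {b b' e} → (∀ i → b i ≈ b' i * e i ^ p) →
      evalMon b m ≈ evalMon b' m * evalMon e m ^ p
    evalMon-rescale {b} {b'} {e} b≈b'eᵖ = begin
      evalMon b m                                      ≈⟨ powProd-cong exps b≈b'eᵖ support ⟩
      powProd (λ i → b' i * e i ^ p) exps support      ≈⟨ powProd-distrib-* exps b' _ support ⟩
      evalMon b' m * powProd (λ i → e i ^ p) exps support
                                                       ≈⟨ *-congˡ (powProd-^ exps e p support) ⟩
      evalMon b' m * evalMon e m ^ p                   ∎

    evalMon-inverse : ∀ {d e} → (∀ i → d i * e i ≈ 1#) → evalMon d m * evalMon e m ≈ 1#
    evalMon-inverse {d} {e} d*e≈1 = begin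
      evalMon d m * evalMon e m                 ≈⟨ powProd-distrib-* exps d e support ⟨
      powProd (λ i → d i * e i) exps support    ≈⟨ powProd-cong exps d*e≈1 support ⟩
      powProd (λ _ → 1#) exps support           ≈⟨ powProd-1 exps support ⟩
      1#                                        ∎

  module _ {r : Level} {A : Carrier → Set r} (A-subring : IsSubring A) where
    open IsSubring A-subring renaming (resp to ∈-resp)

    ^-∈ : ∀ {x} n → A x → A (x ^ n)
    ^-∈ zero    x∈A = 1∈
    ^-∈ (suc n) x∈A = *∈ x∈A (^-∈ n x∈A)

    evalMon-∈ : ∀ {p} {I : Set c} {d : I → Carrier} → (∀ i → A (d i)) →
      (m : Monomial p I) → A (evalMon d m)
    evalMon-∈ {d = d} d∈A m = go (Monomial.support m)
      where
      go : ∀ is → A (powProd d (Monomial.exps m) is)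
      go []       = 1∈
      go (i ∷ is) = *∈ (^-∈ (Monomial.exps m i) (d∈A i)) (go is)

    Frac-isSubfield : IsSubfield (Frac A)
    Frac-isSubfield = record
      { isSubring = record
        { resp = λ { x≈y (a , d , a∈ , d∈ , d≉0 , xd≈a) →
                       a , d , a∈ , d∈ , d≉0 , trans (*-congʳ (sym x≈y)) xd≈a }
        ; 0∈   = 0# , 1# , 0∈ , 1∈ , 1≉0 , *-identityʳ 0#
        ; 1∈   = 1# , 1# , 1∈ , 1∈ , 1≉0 , *-identityʳ 1#
        ; +∈   = Frac-+
        ; -∈   = λ { {x} (a , d , a∈ , d∈ , d≉0 , xd≈a) →
                       - a , d , -∈ a∈ , d∈ , d≉0 , trans (sym (-‿distribˡ-* x d)) (-‿cong xd≈a) }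
        ; *∈   = Frac-*
        }
      ; inv∈ = Frac-inv
      }
      where
      Frac-+ : ∀ {x y} → Frac A x → Frac A y → Frac A (x + y)
      Frac-+ {x} {y} (a , d , a∈ , d∈ , d≉0 , xd≈a) (a' , d' , a'∈ , d'∈ , d'≉0 , yd'≈a') =
        a * d' + a' * d , d * d' , +∈ (*∈ a∈ d'∈) (*∈ a'∈ d∈) , *∈ d∈ d'∈ , *-nonzero d≉0 d'≉0 ,
        (begin
          (x + y) * (d * d')           ≈⟨ solve 4 (λ x y d d' → (x :+ y) :* (d :* d') :=
                                            (x :* d) :* d' :+ (y :* d') :* d) refl x y d d' ⟩
          (x * d) * d' + (y * d') * d  ≈⟨ +-cong (*-congʳ xd≈a) (*-congʳ yd'≈a') ⟩
          a * d' + a' * d              ∎)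

      Frac-* : ∀ {x y} → Frac A x → Frac A y → Frac A (x * y)
      Frac-* {x} {y} (a , d , a∈ , d∈ , d≉0 , xd≈a) (a' , d' , a'∈ , d'∈ , d'≉0 , yd'≈a') =
        a * a' , d * d' , *∈ a∈ a'∈ , *∈ d∈ d'∈ , *-nonzero d≉0 d'≉0 ,
        trans (interchange x y d d') (*-cong xd≈a yd'≈a')

      Frac-inv : ∀ {x y} → Frac A x → ¬ x ≈ 0# → x * y ≈ 1# → Frac A y
      Frac-inv {x} {y} (a , d , a∈ , d∈ , d≉0 , xd≈a) x≉0 xy≈1 =
        d , a , d∈ , a∈ , (λ a≈0 → *-nonzero x≉0 d≉0 (trans xd≈a a≈0)) ,
        (begin
          y * a        ≈⟨ *-congˡ xd≈a ⟨
          y * (x * d)  ≈⟨ solve 3 (λ y x d → y :* (x :* d) := (x :* y) :* d) refl y x d ⟩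
          (x * y) * d  ≈⟨ *-congʳ xy≈1 ⟩
          1# * d       ≈⟨ *-identityˡ d ⟩
          d            ∎)

    denominator : ∀ {x} → Frac A x → Carrier
    denominator (_ , d , _) = d

    denominator-∈ : ∀ {x} (x∈ : Frac A x) → A (denominator x∈)
    denominator-∈ (_ , _ , _ , d∈ , _) = d∈

    denominator≉0 : ∀ {x} (x∈ : Frac A x) → ¬ denominator x∈ ≈ 0#
    denominator≉0 (_ , _ , _ , _ , d≉0 , _) = d≉0

    Frac-clear : ∀ {x} (x∈ : Frac A x) n → A (x * denominator x∈ ^ suc n)
    Frac-clear {x} (a , d , a∈ , d∈ , _ , xd≈a) n =
      ∈-resp (trans (*-congʳ (sym xd≈a)) (*-assoc x d (d ^ n))) (*∈ a∈ (^-∈ n d∈))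

    Frac-unscale : ∀ {x y d e} → A (x * y * e) → A d → d * e ≈ 1# → A y → ¬ y ≈ 0# →
      Frac A x
    Frac-unscale {x} {y} {d} {e} xye∈ d∈ d*e≈1 y∈ y≉0 =
      x * y * e * d , y , *∈ xye∈ d∈ , y∈ , y≉0 ,
      (begin
        x * y                ≈⟨ *-identityʳ (x * y) ⟨
        x * y * 1#           ≈⟨ *-congˡ d*e≈1 ⟨
        x * y * (d * e)      ≈⟨ solve 4 (λ x y d e → x :* y :* (d :* e) := x :* y :* e :* d)
                                  refl x y d e ⟩
        x * y * e * d        ∎)

  Gen-map : ∀ {p r s} {S : Carrier → Set r} {T : Carrier → Set s} →
    (∀ {x} → S x → Gen p T x) → ∀ {x} → Gen p S x → Gen p T x
  Gen-map S⊆T (pth y)            = pth y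
  Gen-map S⊆T (gen x∈S)          = S⊆T x∈S
  Gen-map S⊆T (plus g h)         = plus (Gen-map S⊆T g) (Gen-map S⊆T h)
  Gen-map S⊆T (neg g)            = neg (Gen-map S⊆T g)
  Gen-map S⊆T (mult g h)         = mult (Gen-map S⊆T g) (Gen-map S⊆T h)
  Gen-map S⊆T (inv g x≉0 x*y≈1)  = inv (Gen-map S⊆T g) x≉0 x*y≈1
  Gen-map S⊆T (resp x≈y g)       = resp x≈y (Gen-map S⊆T g)

  module _ {p : ℕ} {I : Set c} {b b' e : I → Carrier} (b≈b'eᵖ : ∀ i → b i ≈ b' i * e i ^ p) where

    Gen-Entries-rescale : ∀ {x} → Gen p (Entries b) x → Gen p (Entries b') x
    Gen-Entries-rescale = Gen-map λ { (j , ≡.refl) →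
      resp (sym (b≈b'eᵖ j)) (mult (gen (j , ≡.refl)) (pth (e j))) }

    PIndep-rescale : {d : I → Carrier} → (∀ i → b' i ≈ b i * d i ^ p) → PIndep p b → PIndep p b'
    PIndep-rescale {d} b'≈bdᵖ b-indep i b'ᵢ∈Gen =
      b-indep i (resp (sym (b≈b'eᵖ i)) (mult (Gen-map rescaled b'ᵢ∈Gen) (pth (e i))))
      where
      rescaled : ∀ {x} → EntriesWithout b' i x → Gen p (EntriesWithout b i) x
      rescaled (j , j≢i , ≡.refl) = resp (sym (b'≈bdᵖ j)) (mult (gen (j , j≢i , ≡.refl)) (pth (d j)))

    rescaleTerm : Carrier → Carrier × Monomial p I → Carrier × Monomial p I
    rescaleTerm y (u , m) = u * y * evalMon e m , m

    Represents-rescale : ∀ {t} y rep → Represents p b t rep →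
      Represents p b' (t * y ^ p) (map (rescaleTerm y) rep)
    Represents-rescale {t} y rep (distinct , t≈sum) =
      AllPairs.map⁺ distinct , trans (*-congʳ t≈sum) (sum-rescale rep)
      where
      sum : (I → Carrier) → List (Carrier × Monomial p I) → Carrier
      sum f = foldr (λ u acc → (proj₁ u ^ p) * evalMon f (proj₂ u) + acc) 0#

      sum-rescale : ∀ rep → sum b rep * y ^ p ≈ sum b' (map (rescaleTerm y) rep)
      sum-rescale []             = zeroˡ _
      sum-rescale ((u , m) ∷ rep) = begin
        (u ^ p * evalMon b m + sum b rep) * y ^ p
          ≈⟨ distribʳ (y ^ p) _ _ ⟩
        u ^ p * evalMon b m * y ^ p + sum b rep * y ^ p
          ≈⟨ +-cong (*-congʳ (*-congˡ (evalMon-rescale m b≈b'eᵖ))) (sum-rescale rep) ⟩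
        u ^ p * (evalMon b' m * evalMon e m ^ p) * y ^ p + sum b' (map (rescaleTerm y) rep)
          ≈⟨ +-congʳ (solve 4 (λ U B E Y → U :* (B :* E) :* Y := (U :* Y :* E) :* B)
                        refl (u ^ p) (evalMon b' m) (evalMon e m ^ p) (y ^ p)) ⟩
        (u ^ p * y ^ p * evalMon e m ^ p) * evalMon b' m + sum b' (map (rescaleTerm y) rep)
          ≈⟨ +-congʳ (*-congʳ (trans (*-congʳ (sym (^-distrib-* u y p)))
                                     (sym (^-distrib-* (u * y) (evalMon e m) p)))) ⟩
        (u * y * evalMon e m) ^ p * evalMon b' m + sum b' (map (rescaleTerm y) rep)  ∎

  Frac-lambdaClosed : ∀ {r} q {A : Carrier → Set r} → IsSubring A →
    LambdaClosed (suc q) A → LambdaClosed (suc q) (Frac A)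
  Frac-lambdaClosed q {A} A-subring A-closed I b b∈ b-indep a a∈ a∈Gen rep a-represented =
    All.map (λ {t} → coefficient∈ t) (All.map⁻ rescaled∈A)
    where
    p = suc q
    d : I → Carrier
    d i = denominator A-subring (b∈ i)
    e : I → Carrier
    e i = proj₁ (inverse (d i) (denominator≉0 A-subring (b∈ i)))
    d*e≈1 : ∀ i → d i * e i ≈ 1#
    d*e≈1 i = proj₂ (inverse (d i) (denominator≉0 A-subring (b∈ i)))
    b' : I → Carrier
    b' i = b i * d i ^ p
    b≈b'eᵖ : ∀ i → b i ≈ b' i * e i ^ p
    b≈b'eᵖ i = x≈x*dⁿ*eⁿ (b i) p (d*e≈1 i)
    y : Carrier
    y = denominator A-subring a∈

    rescaled∈A : All (λ t → A (proj₁ t)) (map (rescaleTerm b≈b'eᵖ y) rep)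
    rescaled∈A = A-closed I b' (λ i → Frac-clear A-subring (b∈ i) q)
      (PIndep-rescale b≈b'eᵖ {d} (λ _ → refl) b-indep)
      (a * y ^ p) (Frac-clear A-subring a∈ q) (mult (Gen-Entries-rescale b≈b'eᵖ a∈Gen) (pth y))
      (map (rescaleTerm b≈b'eᵖ y) rep) (Represents-rescale b≈b'eᵖ y rep a-represented)

    coefficient∈ : ∀ t → A (proj₁ (rescaleTerm b≈b'eᵖ y t)) → Frac A (proj₁ t)
    coefficient∈ (u , m) u*y*eᵐ∈A =
      Frac-unscale A-subring u*y*eᵐ∈A (evalMon-∈ A-subring (λ i → denominator-∈ A-subring (b∈ i)) m)
        (evalMon-inverse m d*e≈1) (denominator-∈ A-subring a∈) (denominator≉0 A-subring a∈)

lemma2p8 : ∀ {c ℓ r : Level} (p : ℕ) → Prime p → (M : Field c ℓ) →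
    let open FieldTheory M in
    HasChar p → (A : Field.Carrier M → Set r) → IsSubring A → LambdaClosed p A →
    IsSubfield (Frac A) × LambdaClosed p (Frac A)
lemma2p8 zero    p-prime M _ A A-subring A-closed with () ← prime⇒nonZero p-prime
lemma2p8 (suc q) _       M _ A A-subring A-closed =
  Frac-isSubfield A-subring , Frac-lambdaClosed q A-subring A-closed
  where open FracLambdaClosed M
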